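{- Let $D$ be a digon-free digraph with $n$ vertices, and let $\tilde{\Delta}=\max\{\sqrt{d^+(v)d^-(v)} : v\in V(D)\}$, where $d^+(v)$ and $d^-(v)$ are the out-degree and in-degree of $v$. Then $\alpha(D)\geq \frac{n}{\frac{2\tilde{\Delta}}{3}+1}$.
   Context: All digraphs are finite, loopless and strict (at most one edge from $u$ to $v$ for distinct $u,v$). A digraph is digon-free if it has no directed cycle of length 2. A vertex set is acyclic if its induced subdigraph has no directed cycle; $\alpha(D)$ is the maximum size of an acyclic vertex set of $D$. -}

module Defs where

open import Data.Nat using (ℕ; zero; suc; _+_; _*_; _∸_; _^_; _≤_; _⊔_)
open import Data.Bool using (Bool; true; false; if_then_else_)
open import Data.Fin using (Fin; zero; suc; inject₁; fromℕ)
open import Data.Fin.Subset using (Subset; _∈_; ∣_∣)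
open import Data.List using (List; map; foldr; allFin)
open import Data.Nat.ListAction using (sum)
open import Data.Product using (Σ; _×_; ∃)
open import Data.Empty using (⊥)
open import Relation.Nullary using (¬_)
open import Relation.Binary.PropositionalEquality using (_≡_)
open import Function.Definitions using (Injective)

-- A (finite, loopless, strict) digraph on vertex set Fin n, given by its
-- adjacency function: E u v ≡ true iff there is an edge u → v.
-- Strictness (at most one edge u → v) is automatic in this representation.
Adj : ℕ → Set
Adj n = Fin n → Fin n → Bool

Loopless : ∀ {n} → Adj n → Set
Loopless {n} E = (v : Fin n) → E v v ≡ false

DigonFree : ∀ {n} → Adj n → Set
DigonFree {n} E = (u v : Fin n) → E u v ≡ true → E v u ≡ false

outdeg : ∀ {n} → Adj n → Fin n → ℕ
outdeg {n} E v = sum (map (λ u → if E v u then 1 else 0) (allFin n))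

indeg : ∀ {n} → Adj n → Fin n → ℕ
indeg {n} E v = sum (map (λ u → if E u v then 1 else 0) (allFin n))

-- max over v of d⁺(v)·d⁻(v)  (so that Δ̃ = √ maxDegProd; 0 if n = 0)
maxDegProd : ∀ {n} → Adj n → ℕ
maxDegProd {n} E = foldr _⊔_ 0 (map (λ v → outdeg E v * indeg E v) (allFin n))

record DirCycleIn {n} (E : Adj n) (S : Subset n) : Set where
  field
    m     : ℕ
    c     : Fin (suc (suc m)) → Fin n
    inj   : Injective _≡_ _≡_ c
    inS   : (i : Fin (suc (suc m))) → c i ∈ S
    step  : (i : Fin (suc m)) → E (c (inject₁ i)) (c (suc i)) ≡ true
    close : E (c (fromℕ (suc m))) (c zero) ≡ true

Acyclic : ∀ {n} → Adj n → Subset n → Set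
Acyclic E S = ¬ DirCycleIn E S

module Submission where

open import Defs
open import Data.Nat using (ℕ; _*_; _∸_; _^_; _≤_)
open import Data.Fin.Subset using (Subset; ∣_∣)
open import Data.Product using (Σ; _×_)

open import Data.Nat using (zero; suc; _+_; _<_; _⊔_; z≤n; s≤s; z<s; NonZero; _!)
open import Data.Nat.Properties hiding (_≟_)
open import Data.Nat.Divisibility using (_∣_; divides; ∣-trans; *-pres-∣; m≤n⇒m!∣n!)
open import Data.Nat.DivMod using (_/_; m*[n/m]≡n)
open import Data.Nat.Tactic.RingSolver using (solve-∀)
import Data.Nat.ListAction as ListNat
open import Data.Bool using (Bool; true; false; if_then_else_; _∨_)
import Data.Bool.Properties as Bool
open import Data.Fin using (Fin; zero; suc; _≟_)
open import Data.Fin.Properties using (all?; punchInᵢ≢i)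
open import Data.Fin.Relation.Unary.Top using (view; ‵fromℕ; ‵inject₁)
open import Data.Vec using (tabulate)
open import Data.Vec.Properties using (lookup∘tabulate; []=⇒lookup)
open import Data.Vec.Functional using (updateAt; removeAt)
open import Data.Vec.Functional.Properties using (updateAt-updates; updateAt-minimal)
import Data.List as List
import Data.List.Properties as List
open import Data.Product using (∃; _,_; proj₁; proj₂)
open import Data.Sum using (_⊎_; inj₁; inj₂)
open import Data.Empty using (⊥; ⊥-elim)
open import Function using (flip; _∘_; mk⇔)
open import Relation.Binary.PropositionalEquality
open import Relation.Nullary using (¬_; yes; no; does; Dec)
open import Relation.Nullary.Decidable using (_→-dec_; dec-true; dec-false; does-⇔)
open import Algebra.Properties.Semiring.Sum +-*-semiring
  using (sum; sum-syntax; sum-cong-≗; sum-remove; ∑-distrib-+; ∑-comm; *-distribˡ-sum; *-distribʳ-sum)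

-- Order the vertices uniformly at random and select v when v
-- comes before all its out-neighbours or before all its in-neighbours.  On a
-- cycle of selected vertices, the one coming last precedes neither its
-- successor nor its predecessor, so the selected set is acyclic.  D being
-- digon-free, the two neighbourhoods of v (of sizes a = d⁺(v), b = d⁻(v)) are
-- disjoint, so v is selected with probability f = 1/(a+1) + 1/(b+1) − 1/(a+b+1),
-- and AM–GM gives 3(1 − f) ≤ 2√(ab)·f ≤ 2Δ̃·f.  The expected size Σ f is
-- attained by some acyclic S (method of conditional expectations), and summing
-- over v gives 3(n − |S|) ≤ 2Δ̃|S|, which is the claim.
--
-- Everything is done over ℕ on the common scale L = ((2n+1)!)³, which every
-- denominator (a+1)(b+1)(a+b+1) divides.

𝟙 : Bool → ℕ
𝟙 b = if b then 1 else 0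

𝟙≤1 : ∀ b → 𝟙 b ≤ 1
𝟙≤1 true  = ≤-refl
𝟙≤1 false = z≤n

∑-mono : ∀ {n} {f g : Fin n → ℕ} → (∀ i → f i ≤ g i) → sum f ≤ sum g
∑-mono {zero}  f≤g = z≤n
∑-mono {suc n} f≤g = +-mono-≤ (f≤g zero) (∑-mono (λ i → f≤g (suc i)))

∑-const : ∀ n c → ∑[ i < n ] c ≡ n * c
∑-const zero    c = refl
∑-const (suc n) c = cong (c +_) (∑-const n c)

∑-<-witness : ∀ {n} (f g : Fin n → ℕ) → sum f < sum g → ∃ λ i → f i < g i
∑-<-witness {zero}  f g ()
∑-<-witness {suc n} f g f<g with f zero <? g zero
... | yes f₀<g₀ = zero , f₀<g₀
... | no  f₀≮g₀ with ∑-<-witness (λ i → f (suc i)) (λ i → g (suc i)) (+-cancelˡ-< (g zero) _ _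
                       (≤-<-trans (+-monoˡ-≤ _ (≮⇒≥ f₀≮g₀)) f<g))
...   | i , fᵢ<gᵢ = suc i , fᵢ<gᵢ

term≤∑ : ∀ {n} (f : Fin n → ℕ) (i : Fin n) → f i ≤ sum f
term≤∑ {suc n} f i = subst (f i ≤_) (sym (sum-remove {i = i} f)) (m≤m+n _ _)

∑-agree-off : ∀ {n} (f g : Fin n → ℕ) (u : Fin n) → (∀ i → ¬ i ≡ u → f i ≡ g i) →
  sum f + g u ≡ sum g + f u
∑-agree-off {suc n} f g u agree = begin
  sum f + g u                      ≡⟨ cong (_+ g u) (sum-remove {i = u} f) ⟩
  f u + sum (removeAt f u) + g u   ≡⟨ cong (λ s → f u + s + g u) rest ⟩
  f u + sum (removeAt g u) + g u   ≡⟨ swap-outer (f u) _ (g u) ⟩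
  g u + sum (removeAt g u) + f u   ≡⟨ cong (_+ f u) (sym (sum-remove {i = u} g)) ⟩
  sum g + f u                      ∎
  where
  open ≡-Reasoning
  rest : sum (removeAt f u) ≡ sum (removeAt g u)
  rest = sum-cong-≗ (λ j → agree _ (punchInᵢ≢i u j))
  swap-outer : ∀ x y z → x + y + z ≡ z + y + x
  swap-outer x y z = begin
    x + y + z   ≡⟨ +-comm (x + y) z ⟩
    z + (x + y) ≡⟨ cong (z +_) (+-comm x y) ⟩
    z + (y + x) ≡⟨ +-assoc z y x ⟨
    z + y + x   ∎

averaging : ∀ {n} (W : Fin n → Bool) (f g : Fin n → ℕ) →
  ∑[ u < n ] (𝟙 (W u) * f u) ≤ ∑[ u < n ] (𝟙 (W u) * g u) → 0 < ∑[ u < n ] 𝟙 (W u) →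
  ∃ λ u → W u ≡ true × f u ≤ g u
averaging {n} W f g ∑f≤∑g nonempty =
  let (u , Fu<Gu) = ∑-<-witness F G F<G in u , term-in-W (W u) (f u) (g u) Fu<Gu
  where
  F G : Fin n → ℕ
  F u = 𝟙 (W u) * f u
  G u = 𝟙 (W u) * g u + 𝟙 (W u)
  F<G : sum F < sum G
  F<G = <-≤-trans (≤-<-trans ∑f≤∑g (m<m+n _ nonempty))
                  (≤-reflexive (sym (∑-distrib-+ (λ u → 𝟙 (W u) * g u) (λ u → 𝟙 (W u)))))
  term-in-W : ∀ b x y → 𝟙 b * x < 𝟙 b * y + 𝟙 b → b ≡ true × x ≤ y
  term-in-W true  x y lt = refl , subst₂ _≤_ (+-identityʳ x) (+-identityʳ y)
                                     (m<1+n⇒m≤n (subst (x + 0 <_) (+-comm (y + 0) 1) lt))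
  term-in-W false x y ()

∑-single : ∀ {n} (w : Fin n) (c : ℕ) → ∑[ u < n ] (𝟙 (does (u ≟ w)) * c) ≡ c
∑-single {n} w c = begin
  sum f                 ≡⟨ +-identityʳ (sum f) ⟨
  sum f + 0             ≡⟨ ∑-agree-off f (λ _ → 0) w off-w ⟩
  ∑[ u < n ] 0 + f w    ≡⟨ cong₂ _+_ (trans (∑-const n 0) (*-zeroʳ n)) at-w ⟩
  0 + c                 ∎
  where
  open ≡-Reasoning
  f : Fin n → ℕ
  f u = 𝟙 (does (u ≟ w)) * c
  off-w : ∀ u → ¬ u ≡ w → f u ≡ 0
  off-w u u≢w = cong (λ b → 𝟙 b * c) (dec-false (u ≟ w) u≢w)
  at-w : f w ≡ c
  at-w = trans (cong (λ b → 𝟙 b * c) (dec-true (w ≟ w) refl)) (*-identityˡ c)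

𝟙*≤ : ∀ b x → 𝟙 b * x ≤ x
𝟙*≤ true  x = ≤-reflexive (*-identityˡ x)
𝟙*≤ false x = z≤n

am-gm-ordered : ∀ a b → a ≤ b → 4 * (a * b) ≤ (a + b) * (a + b)
am-gm-ordered a b a≤b =
  subst (λ b → 4 * (a * b) ≤ (a + b) * (a + b)) (m+[n∸m]≡n a≤b) (square-gap (b ∸ a))
  where
  expand : ∀ a c → 4 * (a * (a + c)) + c * c ≡ (a + (a + c)) * (a + (a + c))
  expand = solve-∀
  square-gap : ∀ c → 4 * (a * (a + c)) ≤ (a + (a + c)) * (a + (a + c))
  square-gap c = subst (4 * (a * (a + c)) ≤_) (expand a c) (m≤m+n _ (c * c))

am-gm : ∀ a b → 4 * (a * b) ≤ (a + b) * (a + b)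
am-gm a b with ≤-total a b
... | inj₁ a≤b = am-gm-ordered a b a≤b
... | inj₂ b≤a = subst₂ _≤_ (cong (4 *_) (*-comm b a)) (cong (λ s → s * s) (+-comm b a))
                   (am-gm-ordered b a b≤a)

-- For out-degree a and in-degree b put P = (a+1)(b+1)(a+b+1).  Then
-- P·(1/(a+1) + 1/(b+1) − 1/(a+b+1)) = selNum a b = (a+b+1)² − ab  and
-- P − selNum a b = rejNum a b = ab(a+b+2).
denom : ℕ → ℕ → ℕ
denom a b = suc a * suc b * suc (a + b)

selNum : ℕ → ℕ → ℕ
selNum a b = a * a + b * b + a * b + 2 * a + 2 * b + 1

rejNum : ℕ → ℕ → ℕ
rejNum a b = a * b * (a + b + 2)

denom-split : ∀ a b → denom a b ≡ rejNum a b + selNum a b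
denom-split = expand
  where
  expand : ∀ a b → suc a * suc b * suc (a + b)
                   ≡ a * b * (a + b + 2) + (a * a + b * b + a * b + 2 * a + 2 * b + 1)
  expand = solve-∀

-- 3(a+b)(a+b+2) ≤ 4·selNum, because 4·selNum + 4ab = 4(a+b+1)².
selNum-lower : ∀ a b → 3 * ((a + b) * (a + b + 2)) ≤ 4 * selNum a b
selNum-lower a b = +-cancelʳ-≤ (4 * (a * b)) _ _ (begin
  3 * ((a + b) * (a + b + 2)) + 4 * (a * b)
    ≤⟨ +-monoʳ-≤ (3 * ((a + b) * (a + b + 2))) (≤-trans (am-gm a b) (m≤m+n _ _)) ⟩
  3 * ((a + b) * (a + b + 2)) + ((a + b) * (a + b) + (2 * (a + b) + 4))
    ≡⟨ expand a b ⟩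
  4 * selNum a b + 4 * (a * b) ∎)
  where
  open ≤-Reasoning
  expand : ∀ a b → 3 * ((a + b) * (a + b + 2)) + ((a + b) * (a + b) + (2 * (a + b) + 4))
                   ≡ 4 * (a * a + b * b + a * b + 2 * a + 2 * b + 1) + 4 * (a * b)
  expand = solve-∀

-- The per-vertex inequality 9(1 − f)² ≤ 4ab·f², cleared of the denominator P.
selection-bound : ∀ a b → 9 * (rejNum a b * rejNum a b) ≤ 4 * (selNum a b * selNum a b) * (a * b)
selection-bound a b = subst₂ _≤_ (regroup-left a b) (regroup-right (selNum a b) (a * b))
  (*-monoʳ-≤ (a * b) (*-cancelˡ-≤ {9 * (a * b) * ((s + 2) * (s + 2))} {4 * (N * N)} 4 quadrupled))
  where
  s N : ℕ
  s = a + b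
  N = selNum a b
  open ≤-Reasoning
  quadrupled : 4 * (9 * (a * b) * ((s + 2) * (s + 2))) ≤ 4 * (4 * (N * N))
  quadrupled = begin
    4 * (9 * (a * b) * ((s + 2) * (s + 2)))  ≡⟨ shuffle (a * b) (s + 2) ⟩
    9 * (4 * (a * b)) * ((s + 2) * (s + 2))  ≤⟨ *-monoˡ-≤ ((s + 2) * (s + 2)) (*-monoʳ-≤ 9 (am-gm a b)) ⟩
    9 * (s * s) * ((s + 2) * (s + 2))        ≡⟨ as-square s ⟩
    (3 * (s * (s + 2))) * (3 * (s * (s + 2))) ≤⟨ *-mono-≤ (selNum-lower a b) (selNum-lower a b) ⟩
    (4 * N) * (4 * N)                         ≡⟨ pull-out N ⟩
    4 * (4 * (N * N))                         ∎
    where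
    shuffle : ∀ p t → 4 * (9 * p * (t * t)) ≡ 9 * (4 * p) * (t * t)
    shuffle = solve-∀
    as-square : ∀ s → 9 * (s * s) * ((s + 2) * (s + 2)) ≡ (3 * (s * (s + 2))) * (3 * (s * (s + 2)))
    as-square = solve-∀
    pull-out : ∀ N → (4 * N) * (4 * N) ≡ 4 * (4 * (N * N))
    pull-out = solve-∀
  regroup-left : ∀ a b → a * b * (9 * (a * b) * ((a + b + 2) * (a + b + 2)))
                         ≡ 9 * (a * b * (a + b + 2) * (a * b * (a + b + 2)))
  regroup-left = solve-∀
  regroup-right : ∀ N p → p * (4 * (N * N)) ≡ 4 * (N * N) * p
  regroup-right N p = *-comm p (4 * (N * N))

-- Selection values of a vertex with out-degree a and in-degree b on the scale L.
-- value o i is L times the probability that the vertex still gets selected,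
-- given whether its out-neighbours (o) / in-neighbours (i) are all still
-- unremoved; removing one out- (in-)neighbour costs at most outLoss (inLoss),
-- and the expected loss charged to the vertex is covered by its own chance
-- L·[o ∨ i] of being selected when it is removed itself (budget).
record SelectionValues (L a b : ℕ) : Set where
  field
    value     : Bool → Bool → ℕ
    outLoss   : Bool → Bool → ℕ
    inLoss    : Bool → Bool → ℕ
    value-out : ∀ o i → value o i ≤ value false i + outLoss o i
    value-in  : ∀ o i → value o i ≤ value o false + inLoss o i
    budget    : ∀ o i → value o i + a * outLoss o i + b * inLoss o i ≤ L * 𝟙 (o ∨ i)

-- The values of the random-order selection, on a scale L = t·(a+1)(b+1)(a+b+1):
-- probability 1/(a+1)+1/(b+1)−1/(a+b+1), 1/(a+1), 1/(b+1) or 0.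
orderValues : ∀ a b t L → t * denom a b ≡ L → SelectionValues L a b
orderValues a b t L tP≡L = record
  { value = value ; outLoss = outLoss ; inLoss = inLoss
  ; value-out = value-out ; value-in = value-in ; budget = budget }
  where
  value : Bool → Bool → ℕ
  value true  true  = t * selNum a b
  value true  false = t * (suc b * suc (a + b))
  value false true  = t * (suc a * suc (a + b))
  value false false = 0

  outLoss : Bool → Bool → ℕ
  outLoss true  true  = t * (b * suc b)
  outLoss true  false = value true false
  outLoss false _     = 0

  inLoss : Bool → Bool → ℕ
  inLoss true  true  = t * (a * suc a)
  inLoss false true  = value false true
  inLoss true  false = 0
  inLoss false false = 0

  value-out : ∀ o i → value o i ≤ value false i + outLoss o i
  value-out true  true  = ≤-reflexive (lose-out a b t)
    where
    lose-out : ∀ a b t → t * (a * a + b * b + a * b + 2 * a + 2 * b + 1)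
                         ≡ t * (suc a * suc (a + b)) + t * (b * suc b)
    lose-out = solve-∀
  value-out true  false = ≤-refl
  value-out false i     = m≤m+n (value false i) 0

  value-in : ∀ o i → value o i ≤ value o false + inLoss o i
  value-in true  true  = ≤-reflexive (lose-in a b t)
    where
    lose-in : ∀ a b t → t * (a * a + b * b + a * b + 2 * a + 2 * b + 1)
                        ≡ t * (suc b * suc (a + b)) + t * (a * suc a)
    lose-in = solve-∀
  value-in false true  = ≤-refl
  value-in true  false = m≤m+n (value true false) 0
  value-in false false = ≤-refl

  selected : ∀ o i → value o i + a * outLoss o i + b * inLoss o i ≡ t * denom a b * 𝟙 (o ∨ i)
  selected true  true  = both a b t
    where
    both : ∀ a b t → t * (a * a + b * b + a * b + 2 * a + 2 * b + 1)
                       + a * (t * (b * suc b)) + b * (t * (a * suc a))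
                     ≡ t * (suc a * suc b * suc (a + b)) * 1
    both = solve-∀
  selected true  false = out-only a b t
    where
    out-only : ∀ a b t → t * (suc b * suc (a + b)) + a * (t * (suc b * suc (a + b))) + b * 0
                         ≡ t * (suc a * suc b * suc (a + b)) * 1
    out-only = solve-∀
  selected false true  = in-only a b t
    where
    in-only : ∀ a b t → t * (suc a * suc (a + b)) + a * 0 + b * (t * (suc a * suc (a + b)))
                        ≡ t * (suc a * suc b * suc (a + b)) * 1
    in-only = solve-∀
  selected false false = neither a b t
    where
    neither : ∀ a b t → 0 + a * 0 + b * 0 ≡ t * (suc a * suc b * suc (a + b)) * 0
    neither = solve-∀

  budget : ∀ o i → value o i + a * outLoss o i + b * inLoss o i ≤ L * 𝟙 (o ∨ i)
  budget o i = ≤-reflexive (trans (selected o i) (cong (_* 𝟙 (o ∨ i)) tP≡L))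

VSet : ℕ → Set
VSet n = Fin n → Bool

size : ∀ {n} → VSet n → ℕ
size {n} W = ∑[ v < n ] 𝟙 (W v)

∣tabulate∣ : ∀ {n} (W : VSet n) → ∣ tabulate W ∣ ≡ size W
∣tabulate∣ {zero}  W = refl
∣tabulate∣ {suc n} W with W zero
... | true  = cong suc (∣tabulate∣ (λ v → W (suc v)))
... | false = ∣tabulate∣ (λ v → W (suc v))

size-updateAt : ∀ {n} (W : VSet n) (u : Fin n) (b : Bool) →
  size (updateAt W u (λ _ → b)) + 𝟙 (W u) ≡ size W + 𝟙 b
size-updateAt W u b = trans
  (∑-agree-off (λ v → 𝟙 (updateAt W u (λ _ → b) v)) (λ v → 𝟙 (W v)) u
     (λ v v≢u → cong 𝟙 (updateAt-minimal v u W v≢u)))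
  (cong (λ x → size W + 𝟙 x) (updateAt-updates u W))

size≡0⇒empty : ∀ {n} (W : VSet n) → size W ≡ 0 → ∀ v → W v ≡ false
size≡0⇒empty W size≡0 v with W v in Wv
... | false = refl
... | true  = ⊥-elim (1+n≰n (subst (1 ≤_) size≡0
                (subst (λ x → 𝟙 x ≤ size W) Wv (term≤∑ (λ v → 𝟙 (W v)) v))))

outdeg-sum : ∀ {n} (E : Adj n) (v : Fin n) → outdeg E v ≡ ∑[ u < n ] 𝟙 (E v u)
outdeg-sum {n} E v = trans (cong ListNat.sum (List.map-tabulate (λ u → u) (λ u → 𝟙 (E v u))))
                           (list-sum (λ u → 𝟙 (E v u)))
  where
  list-sum : ∀ {m} (f : Fin m → ℕ) → ListNat.sum (List.tabulate f) ≡ sum f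
  list-sum {zero}  f = refl
  list-sum {suc m} f = cong (f zero +_) (list-sum (λ i → f (suc i)))

≤maxDegProd : ∀ {n} (E : Adj n) (v : Fin n) → outdeg E v * indeg E v ≤ maxDegProd E
≤maxDegProd {n} E v = subst (f v ≤_) (cong (List.foldr _⊔_ 0) (sym (List.map-tabulate (λ u → u) f)))
                             (term≤max f v)
  where
  f : Fin n → ℕ
  f u = outdeg E u * indeg E u
  term≤max : ∀ {m} (g : Fin m → ℕ) (i : Fin m) → g i ≤ List.foldr _⊔_ 0 (List.tabulate g)
  term≤max g zero    = m≤m⊔n _ _
  term≤max g (suc i) = ≤-trans (term≤max (λ j → g (suc j)) i) (m≤n⊔m (g zero) _)

true≢false : ¬ true ≡ false
true≢false ()


-- v is E-closed in W when all its out-neighbours lie in W; applied to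
-- flip E this says that all its in-neighbours lie in W.
Closed : ∀ {n} → Adj n → VSet n → Fin n → Set
Closed {n} E W v = (u : Fin n) → E v u ≡ true → W u ≡ true

closed? : ∀ {n} (E : Adj n) (W : VSet n) (v : Fin n) → Dec (Closed E W v)
closed? E W v = all? (λ u → (E v u Bool.≟ true) →-dec (W u Bool.≟ true))

remove : ∀ {n} → VSet n → Fin n → VSet n
remove W u = updateAt W u (λ _ → false)

removed-≢ : ∀ {n} (W : VSet n) (u v : Fin n) → remove W u v ≡ true → ¬ v ≡ u
removed-≢ W u v v∈W-u refl = true≢false (trans (sym v∈W-u) (updateAt-updates u W))

remove-⊆ : ∀ {n} (W : VSet n) (u v : Fin n) → remove W u v ≡ true → W v ≡ true
remove-⊆ W u v v∈W-u = trans (sym (updateAt-minimal v u W (removed-≢ W u v v∈W-u))) v∈W-u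

size-remove : ∀ {n} (W : VSet n) (u : Fin n) → W u ≡ true → suc (size (remove W u)) ≡ size W
size-remove W u u∈W = trans (+-comm 1 (size (remove W u)))
  (trans (subst (λ b → size (remove W u) + 𝟙 b ≡ size W + 0) u∈W (size-updateAt W u false))
         (+-identityʳ (size W)))

closed-lost : ∀ {n} (E : Adj n) (W : VSet n) (u v : Fin n) → E v u ≡ true →
  does (closed? E (remove W u) v) ≡ false
closed-lost E W u v evu = dec-false (closed? E (remove W u) v)
  (λ closed → true≢false (trans (sym (closed u evu)) (updateAt-updates u W)))

closed-kept : ∀ {n} (E : Adj n) (W : VSet n) (u v : Fin n) → E v u ≡ false →
  does (closed? E (remove W u) v) ≡ does (closed? E W v)
closed-kept E W u v evu = does-⇔ (mk⇔ shrink extend) (closed? E (remove W u) v) (closed? E W v)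
  where
  shrink : Closed E (remove W u) v → Closed E W v
  shrink closed x evx = remove-⊆ W u x (closed x evx)
  extend : Closed E W v → Closed E (remove W u) v
  extend closed x evx = trans (updateAt-minimal x u W x≢u) (closed x evx)
    where
    x≢u : ¬ x ≡ u
    x≢u refl = true≢false (trans (sym evx) evu)

-- Ranks certifying acyclicity: all E-out-neighbours of v lie in W with
-- smaller rank.  Flipping E gives the same statement for in-neighbours.
Below : ∀ {n} → Adj n → VSet n → (Fin n → ℕ) → Fin n → Set
Below {n} E W rank v = (u : Fin n) → E v u ≡ true → W u ≡ true × rank u < rank v

argmin : ∀ {k} (g : Fin (suc k) → ℕ) → ∃ λ j → ∀ i → g j ≤ g i
argmin {zero}  g = zero , λ { zero → ≤-refl }
argmin {suc k} g with argmin (λ i → g (suc i))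
... | j , min-j with g zero ≤? g (suc j)
...   | yes g₀≤ = zero  , λ { zero → ≤-refl ; (suc i) → ≤-trans g₀≤ (min-j i) }
...   | no  g₀≰ = suc j , λ { zero → <⇒≤ (≰⇒> g₀≰) ; (suc i) → min-j i }

-- If every vertex of S has all its out-neighbours or all its in-neighbours
-- of smaller rank, then S is acyclic: the vertex of minimum rank on a cycle
-- has both its cycle-successor and cycle-predecessor of no smaller rank.
ranked⇒acyclic : ∀ {n} (E : Adj n) (W S : VSet n) (rank : Fin n → ℕ) →
  (∀ v → S v ≡ true → Below E W rank v ⊎ Below (flip E) W rank v) →
  Acyclic E (tabulate S)
ranked⇒acyclic E W S rank certified cycle with argmin (λ i → rank (DirCycleIn.c cycle i))
... | j , min-j = refute (certified (c j) (in-S j))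
  where
  open DirCycleIn cycle
  in-S : ∀ i → S (c i) ≡ true
  in-S i = trans (sym (lookup∘tabulate S (c i))) ([]=⇒lookup (inS i))
  successor : ∀ i → ∃ λ i′ → E (c i) (c i′) ≡ true
  successor i with view i
  ... | ‵fromℕ     = zero , close
  ... | ‵inject₁ k = suc k , step k
  predecessor : ∀ i → ∃ λ i′ → E (c i′) (c i) ≡ true
  predecessor zero    = _ , close
  predecessor (suc k) = _ , step k
  refute : Below E W rank (c j) ⊎ Below (flip E) W rank (c j) → ⊥
  refute (inj₁ below) = let (i , e) = successor j   in <⇒≱ (proj₂ (below (c i) e)) (min-j i)
  refute (inj₂ below) = let (i , e) = predecessor j in <⇒≱ (proj₂ (below (c i) e)) (min-j i)

-- The state is the set W of vertices
-- not yet removed, and the potential Ψ(W) sums the current values of its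
-- members (for the random-order values: L times the expected number of them
-- still to be selected).  Averaging finds a u ∈ W whose removal costs the
-- potential at most L·[u is out- or in-closed]; removing u and selecting it
-- when it is closed keeps Ψ(W) ≤ L·(number selected later).
module Greedy {n : ℕ} (E : Adj n) (loopless : Loopless E) (digonFree : DigonFree E)
              (L : ℕ) (sv : (v : Fin n) → SelectionValues L (outdeg E v) (indeg E v)) where

  open SelectionValues

  out? in? : VSet n → Fin n → Bool
  out? W v = does (closed? E W v)
  in?  W v = does (closed? (flip E) W v)

  live outL inL : VSet n → Fin n → ℕ
  live W w = value   (sv w) (out? W w) (in? W w)
  outL W w = outLoss (sv w) (out? W w) (in? W w)
  inL  W w = inLoss  (sv w) (out? W w) (in? W w)

  potential : VSet n → Fin n → ℕ
  potential W w = if W w then live W w else 0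

  Ψ : VSet n → ℕ
  Ψ W = sum (potential W)

  charge : VSet n → Fin n → Fin n → ℕ
  charge W w u = 𝟙 (does (u ≟ w)) * live W w + 𝟙 (E w u) * outL W w + 𝟙 (E u w) * inL W w

  cost : VSet n → Fin n → ℕ
  cost W u = ∑[ w < n ] (𝟙 (W w) * charge W w u)

  potential-in : ∀ W w → W w ≡ true → potential W w ≡ live W w
  potential-in W w w∈W = cong (λ b → if b then live W w else 0) w∈W

  potential-out : ∀ W w → W w ≡ false → potential W w ≡ 0
  potential-out W w w∉W = cong (λ b → if b then live W w else 0) w∉W

  live-step : ∀ W u w → ¬ w ≡ u →
    live W w ≤ live (remove W u) w + (𝟙 (E w u) * outL W w + 𝟙 (E u w) * inL W w)
  live-step W u w w≢u with E w u in ewu | E u w in euw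
  ... | true  | true  = ⊥-elim (true≢false (trans (sym euw) (digonFree w u ewu)))
  ... | true  | false = begin
    live W w                                            ≤⟨ value-out (sv w) _ _ ⟩
    value (sv w) false (in? W w) + outL W w             ≡⟨ cong₂ (λ o i → value (sv w) o i + outL W w)
                                                             (closed-lost E W u w ewu)
                                                             (closed-kept (flip E) W u w euw) ⟨
    live (remove W u) w + outL W w                      ≤⟨ +-monoʳ-≤ (live (remove W u) w) (≤-trans (m≤m+n _ 0) (m≤m+n _ 0)) ⟩
    live (remove W u) w + (outL W w + 0 + 0)            ∎
    where open ≤-Reasoning
  ... | false | true  = begin
    live W w                                            ≤⟨ value-in (sv w) _ _ ⟩
    value (sv w) (out? W w) false + inL W w             ≡⟨ cong₂ (λ o i → value (sv w) o i + inL W w)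
                                                             (closed-kept E W u w ewu)
                                                             (closed-lost (flip E) W u w euw) ⟨
    live (remove W u) w + inL W w                       ≤⟨ +-monoʳ-≤ (live (remove W u) w) (m≤m+n _ 0) ⟩
    live (remove W u) w + (inL W w + 0)                 ∎
    where open ≤-Reasoning
  ... | false | false = begin
    live W w                                            ≡⟨ cong₂ (value (sv w))
                                                             (closed-kept E W u w ewu)
                                                             (closed-kept (flip E) W u w euw) ⟨
    live (remove W u) w                                 ≤⟨ m≤m+n _ 0 ⟩
    live (remove W u) w + 0                             ∎
    where open ≤-Reasoning

  potential-step : ∀ W u w → potential W w ≤ potential (remove W u) w + 𝟙 (W w) * charge W w u
  potential-step W u w with W w in w∈W
  ... | false = z≤n
  ... | true with w ≟ u
  ...   | yes refl = begin
    live W w                                            ≡⟨ *-identityˡ (live W w) ⟨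
    1 * live W w                                        ≡⟨ cong (λ b → 𝟙 b * live W w) (dec-true (w ≟ w) refl) ⟨
    𝟙 (does (w ≟ w)) * live W w                         ≤⟨ ≤-trans (m≤m+n _ _) (m≤m+n _ _) ⟩
    charge W w w                                        ≡⟨ cong (_+ charge W w w) (potential-out (remove W w) w (updateAt-updates w W)) ⟨
    potential (remove W w) w + charge W w w             ≡⟨ cong (potential (remove W w) w +_) (*-identityˡ (charge W w w)) ⟨
    potential (remove W w) w + 1 * charge W w w         ∎
    where open ≤-Reasoning
  ...   | no w≢u = begin
    live W w                                            ≤⟨ live-step W u w w≢u ⟩
    live (remove W u) w + loss                          ≡⟨ cong₂ _+_ (potential-in (remove W u) w (trans (updateAt-minimal w u W w≢u) w∈W))
                                                                     (cong (λ b → 𝟙 b * live W w + 𝟙 (E w u) * outL W w + 𝟙 (E u w) * inL W w)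
                                                                           (dec-false (u ≟ w) (w≢u ∘ sym))) ⟨
    potential (remove W u) w + charge W w u             ≡⟨ cong (potential (remove W u) w +_) (*-identityˡ (charge W w u)) ⟨
    potential (remove W u) w + 1 * charge W w u         ∎
    where
    open ≤-Reasoning
    loss : ℕ
    loss = 𝟙 (E w u) * outL W w + 𝟙 (E u w) * inL W w

  Ψ-step : ∀ W u → Ψ W ≤ Ψ (remove W u) + cost W u
  Ψ-step W u = ≤-trans (∑-mono (potential-step W u))
                       (≤-reflexive (∑-distrib-+ (potential (remove W u)) (λ w → 𝟙 (W w) * charge W w u)))

  -- w is selected when it is removed while still out- or in-closed
  selectable : VSet n → Fin n → Bool
  selectable W w = out? W w ∨ in? W w

  charge-total : ∀ W w → ∑[ u < n ] charge W w u ≤ L * 𝟙 (selectable W w)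
  charge-total W w = begin
    ∑[ u < n ] charge W w u                                  ≡⟨ split ⟩
    sum self + sum out + sum into                            ≡⟨ cong₂ (λ x y → x + y + sum into)
                                                                  (∑-single w (live W w)) (weighted-degree E (outL W w)) ⟩
    live W w + outdeg E w * outL W w + sum into              ≡⟨ cong (live W w + outdeg E w * outL W w +_)
                                                                  (weighted-degree (flip E) (inL W w)) ⟩
    live W w + outdeg E w * outL W w + indeg E w * inL W w   ≤⟨ budget (sv w) (out? W w) (in? W w) ⟩
    L * 𝟙 (selectable W w)                                   ∎
    where
    open ≤-Reasoning
    self out into : Fin n → ℕ
    self u = 𝟙 (does (u ≟ w)) * live W w
    out  u = 𝟙 (E w u) * outL W w
    into u = 𝟙 (E u w) * inL W w
    split : ∑[ u < n ] charge W w u ≡ sum self + sum out + sum into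
    split = trans (∑-distrib-+ (λ u → self u + out u) into) (cong (_+ sum into) (∑-distrib-+ self out))
    -- indeg E w is outdeg (flip E) w
    weighted-degree : ∀ F c → ∑[ u < n ] (𝟙 (F w u) * c) ≡ outdeg F w * c
    weighted-degree F c = trans (sym (*-distribʳ-sum c (λ u → 𝟙 (F w u)))) (cong (_* c) (sym (outdeg-sum F w)))

  total-cost : ∀ W → ∑[ u < n ] (𝟙 (W u) * cost W u) ≤ ∑[ u < n ] (𝟙 (W u) * (L * 𝟙 (selectable W u)))
  total-cost W = begin
    ∑[ u < n ] (𝟙 (W u) * cost W u)                       ≤⟨ ∑-mono (λ u → 𝟙*≤ (W u) (cost W u)) ⟩
    ∑[ u < n ] ∑[ w < n ] (𝟙 (W w) * charge W w u)        ≡⟨ ∑-comm (λ u w → 𝟙 (W w) * charge W w u) ⟩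
    ∑[ w < n ] ∑[ u < n ] (𝟙 (W w) * charge W w u)        ≡⟨ sum-cong-≗ (λ w → *-distribˡ-sum (𝟙 (W w)) (charge W w)) ⟨
    ∑[ w < n ] (𝟙 (W w) * ∑[ u < n ] charge W w u)        ≤⟨ ∑-mono (λ w → *-monoʳ-≤ (𝟙 (W w)) (charge-total W w)) ⟩
    ∑[ w < n ] (𝟙 (W w) * (L * 𝟙 (selectable W w)))       ∎
    where open ≤-Reasoning

  -- The invariant of the greedy process on the remaining set W: a chosen set
  -- inside W, certified by ranks below size W, whose size pays for Ψ(W).
  record Selection (W : VSet n) : Set where
    field
      chosen     : VSet n
      rank       : Fin n → ℕ
      chosen⊆W   : ∀ v → chosen v ≡ true → W v ≡ true
      certified  : ∀ v → chosen v ≡ true → Below E W rank v ⊎ Below (flip E) W rank v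
      rank<size  : ∀ v → W v ≡ true → rank v < size W
      Ψ≤         : Ψ W ≤ L * size chosen

  empty-selection : ∀ W → size W ≡ 0 → Selection W
  empty-selection W size≡0 = record
    { chosen = λ _ → false ; rank = λ _ → 0 ; chosen⊆W = λ _ () ; certified = λ _ ()
    ; rank<size = λ v v∈W → ⊥-elim (true≢false (trans (sym v∈W) (size≡0⇒empty W size≡0 v)))
    ; Ψ≤ = subst (_≤ L * size {n} (λ _ → false)) (sym Ψ≡0) z≤n }
    where
    Ψ≡0 : Ψ W ≡ 0
    Ψ≡0 = trans (sum-cong-≗ (λ w → potential-out W w (size≡0⇒empty W size≡0 w)))
                (trans (∑-const n 0) (*-zeroʳ n))

  -- One greedy step: remove u ∈ W, whose cost is paid by its own selection,
  -- and select u when it is still closed; u gets the largest rank so far.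
  extend : ∀ W u → W u ≡ true → cost W u ≤ L * 𝟙 (selectable W u) →
    Selection (remove W u) → Selection W
  extend W u u∈W cost≤ rest = record
    { chosen = chosen ; rank = rank ; chosen⊆W = chosen⊆W ; certified = certified
    ; rank<size = rank<size ; Ψ≤ = Ψ≤ }
    where
    module R = Selection rest
    W′ : VSet n
    W′ = remove W u

    chosen : VSet n
    chosen = updateAt R.chosen u (λ _ → selectable W u)
    rank : Fin n → ℕ
    rank = updateAt R.rank u (λ _ → size W′)

    W′<W : size W′ < size W
    W′<W = ≤-reflexive (size-remove W u u∈W)
    u∉chosen′ : R.chosen u ≡ false
    u∉chosen′ with R.chosen u in eq
    ... | false = refl
    ... | true  = ⊥-elim (removed-≢ W u u (R.chosen⊆W u eq) refl)
    size-chosen : size chosen ≡ size R.chosen + 𝟙 (selectable W u)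
    size-chosen = trans (sym (+-identityʳ (size chosen)))
      (subst (λ b → size chosen + 𝟙 b ≡ size R.chosen + 𝟙 (selectable W u)) u∉chosen′
             (size-updateAt R.chosen u (selectable W u)))

    lift : ∀ {x} → W′ x ≡ true → W x ≡ true × rank x ≡ R.rank x
    lift {x} x∈W′ = remove-⊆ W u x x∈W′ , updateAt-minimal x u R.rank (removed-≢ W u x x∈W′)
    below-u : ∀ x → W′ x ≡ true → rank x < rank u
    below-u x x∈W′ = subst₂ _<_ (sym (proj₂ (lift x∈W′))) (sym (updateAt-updates u R.rank)) (R.rank<size x x∈W′)

    chosen⊆W : ∀ v → chosen v ≡ true → W v ≡ true
    chosen⊆W v v∈chosen with v ≟ u
    ... | yes refl = u∈W
    ... | no  v≢u  = remove-⊆ W u v (R.chosen⊆W v (trans (sym (updateAt-minimal v u R.chosen v≢u)) v∈chosen))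

    -- the closed neighbourhood of u survives in W′ (no loops)
    into-W′ : ∀ (F : Adj n) → (∀ x → F u x ≡ true → ¬ x ≡ u) → Closed F W u → Below F W rank u
    into-W′ F closed-nonloop closed x fux = closed x fux , below-u x
      (trans (updateAt-minimal x u W (closed-nonloop x fux)) (closed x fux))
    out-nonloop : ∀ x → E u x ≡ true → ¬ x ≡ u
    out-nonloop x eux refl = true≢false (trans (sym eux) (loopless u))
    in-nonloop : ∀ x → E x u ≡ true → ¬ x ≡ u
    in-nonloop x exu refl = true≢false (trans (sym exu) (loopless u))

    certify-u : selectable W u ≡ true → Below E W rank u ⊎ Below (flip E) W rank u
    certify-u = by-flags (closed? E W u) (closed? (flip E) W u)
      where
      by-flags : (o : Dec (Closed E W u)) (i : Dec (Closed (flip E) W u)) → does o ∨ does i ≡ true →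
        Below E W rank u ⊎ Below (flip E) W rank u
      by-flags (yes out-closed) _               _ = inj₁ (into-W′ E out-nonloop out-closed)
      by-flags (no _)           (yes in-closed) _ = inj₂ (into-W′ (flip E) in-nonloop in-closed)
      by-flags (no _)           (no _)          ()

    lift-below : ∀ (F : Adj n) v → ¬ v ≡ u → Below F W′ R.rank v → Below F W rank v
    lift-below F v v≢u below x fvx with below x fvx
    ... | x∈W′ , lt = proj₁ (lift x∈W′) , subst₂ _<_ (sym (proj₂ (lift x∈W′)))
                                                      (sym (updateAt-minimal v u R.rank v≢u)) lt

    certified : ∀ v → chosen v ≡ true → Below E W rank v ⊎ Below (flip E) W rank v
    certified v v∈chosen with v ≟ u
    ... | yes refl = certify-u (trans (sym (updateAt-updates u R.chosen)) v∈chosen)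
    ... | no  v≢u  with R.certified v (trans (sym (updateAt-minimal v u R.chosen v≢u)) v∈chosen)
    ...   | inj₁ below = inj₁ (lift-below E v v≢u below)
    ...   | inj₂ below = inj₂ (lift-below (flip E) v v≢u below)

    rank<size : ∀ v → W v ≡ true → rank v < size W
    rank<size v v∈W with v ≟ u
    ... | yes refl = subst (_< size W) (sym (updateAt-updates u R.rank)) W′<W
    ... | no  v≢u  = <-trans (subst (_< size W′) (sym (updateAt-minimal v u R.rank v≢u))
                               (R.rank<size v (trans (updateAt-minimal v u W v≢u) v∈W)))
                             W′<W

    Ψ≤ : Ψ W ≤ L * size chosen
    Ψ≤ = begin
      Ψ W                                      ≤⟨ Ψ-step W u ⟩
      Ψ W′ + cost W u                          ≤⟨ +-mono-≤ R.Ψ≤ cost≤ ⟩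
      L * size R.chosen + L * 𝟙 (selectable W u) ≡⟨ *-distribˡ-+ L _ _ ⟨
      L * (size R.chosen + 𝟙 (selectable W u)) ≡⟨ cong (L *_) size-chosen ⟨
      L * size chosen                          ∎
      where open ≤-Reasoning

  selection : ∀ k W → size W ≡ k → Selection W
  selection zero    W size≡0 = empty-selection W size≡0
  selection (suc k) W size≡k+1 with averaging W (cost W) (λ u → L * 𝟙 (selectable W u))
                                      (total-cost W) (subst (0 <_) (sym size≡k+1) z<s)
  ... | u , u∈W , cost≤ = extend W u u∈W cost≤
                             (selection k (remove W u) (suc-injective (trans (size-remove W u u∈W) size≡k+1)))

  full : VSet n
  full _ = true

  Ψ-full : Ψ full ≡ ∑[ v < n ] value (sv v) true true
  Ψ-full = sum-cong-≗ (λ v → cong₂ (value (sv v)) (dec-true (closed? E full v) (λ _ _ → refl))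
                                                   (dec-true (closed? (flip E) full v) (λ _ _ → refl)))

  greedy-selection : Σ (VSet n) λ S → Acyclic E (tabulate S) × ∑[ v < n ] value (sv v) true true ≤ L * size S
  greedy-selection = chosen , ranked⇒acyclic E full chosen rank certified , subst (_≤ L * size chosen) Ψ-full Ψ≤
    where
    open Selection (selection n full (trans (∑-const n 1) (*-identityʳ n)))

square-cancel : ∀ p r → p * p ≤ r * r → p ≤ r
square-cancel p r p²≤r² with p ≤? r
... | yes p≤r = p≤r
... | no  p≰r = ⊥-elim (<⇒≱ (*-mono-< (≰⇒> p≰r) (≰⇒> p≰r)) p²≤r²)

-- Bounds c·x² ≤ K·y² add up (the square-root form of the bound is additive):
-- the cross terms compare because (cxu)² = (cx²)(cu²) ≤ (Ky²)(Kw²) = (Kyw)².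
square-bound-+ : ∀ c K x y u w → c * (x * x) ≤ K * (y * y) → c * (u * u) ≤ K * (w * w) →
  c * ((x + u) * (x + u)) ≤ K * ((y + w) * (y + w))
square-bound-+ c K x y u w x≤y u≤w = begin
  c * ((x + u) * (x + u))                          ≡⟨ expand c x u ⟩
  c * (x * x) + 2 * (c * x * u) + c * (u * u)      ≤⟨ +-mono-≤ (+-mono-≤ x≤y (*-monoʳ-≤ 2 cross)) u≤w ⟩
  K * (y * y) + 2 * (K * y * w) + K * (w * w)      ≡⟨ expand K y w ⟨
  K * ((y + w) * (y + w))                          ∎
  where
  open ≤-Reasoning
  expand : ∀ c x u → c * ((x + u) * (x + u)) ≡ c * (x * x) + 2 * (c * x * u) + c * (u * u)
  expand = solve-∀
  as-product : ∀ c x u → (c * x * u) * (c * x * u) ≡ (c * (x * x)) * (c * (u * u))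
  as-product = solve-∀
  cross : c * x * u ≤ K * y * w
  cross = square-cancel _ _ (subst₂ _≤_ (sym (as-product c x u)) (sym (as-product K y w)) (*-mono-≤ x≤y u≤w))

square-bound-∑ : ∀ {m} c K (x y : Fin m → ℕ) → (∀ v → c * (x v * x v) ≤ K * (y v * y v)) →
  c * (sum x * sum x) ≤ K * (sum y * sum y)
square-bound-∑ {zero}  c K x y x≤y = subst (_≤ K * 0) (sym (*-zeroʳ c)) z≤n
square-bound-∑ {suc m} c K x y x≤y = square-bound-+ c K (x zero) (y zero) _ _ (x≤y zero)
  (square-bound-∑ c K (λ i → x (suc i)) (λ i → y (suc i)) (λ i → x≤y (suc i)))

clear-scale : ∀ n L s M Ψ X → .{{_ : NonZero L}} → X + Ψ ≡ n * L → Ψ ≤ L * s →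
  9 * (X * X) ≤ (4 * M) * (Ψ * Ψ) → 9 * (n ∸ s) ^ 2 ≤ 4 * s ^ 2 * M
clear-scale n L s M Ψ X X+Ψ≡nL Ψ≤Ls X≤Ψ =
  subst₂ _≤_ (cong (9 *_) (sym (square (n ∸ s)))) (cong (λ z → 4 * z * M) (sym (square s)))
    (*-cancelʳ-≤ _ _ (L * L) {{m*n≢0 L L}} scaled)
  where
  square : ∀ x → x ^ 2 ≡ x * x
  square x = cong (x *_) (*-identityʳ x)
  L[n-s]≤X : L * (n ∸ s) ≤ X
  L[n-s]≤X = begin
    L * (n ∸ s)   ≡⟨ *-distribˡ-∸ L n s ⟩
    L * n ∸ L * s ≤⟨ ∸-monoʳ-≤ (L * n) Ψ≤Ls ⟩
    L * n ∸ Ψ     ≡⟨ cong (_∸ Ψ) (trans (*-comm L n) (sym X+Ψ≡nL)) ⟩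
    X + Ψ ∸ Ψ     ≡⟨ m+n∸n≡m X Ψ ⟩
    X             ∎
    where open ≤-Reasoning
  scaled : 9 * ((n ∸ s) * (n ∸ s)) * (L * L) ≤ 4 * (s * s) * M * (L * L)
  scaled = begin
    9 * ((n ∸ s) * (n ∸ s)) * (L * L)        ≡⟨ regroup-left (n ∸ s) L ⟩
    9 * ((L * (n ∸ s)) * (L * (n ∸ s)))      ≤⟨ *-monoʳ-≤ 9 (*-mono-≤ L[n-s]≤X L[n-s]≤X) ⟩
    9 * (X * X)                              ≤⟨ X≤Ψ ⟩
    (4 * M) * (Ψ * Ψ)                        ≤⟨ *-monoʳ-≤ (4 * M) (*-mono-≤ Ψ≤Ls Ψ≤Ls) ⟩
    (4 * M) * ((L * s) * (L * s))            ≡⟨ regroup-right M L s ⟩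
    4 * (s * s) * M * (L * L)                ∎
    where
    open ≤-Reasoning
    regroup-left : ∀ d L → 9 * (d * d) * (L * L) ≡ 9 * ((L * d) * (L * d))
    regroup-left = solve-∀
    regroup-right : ∀ M L s → (4 * M) * ((L * s) * (L * s)) ≡ 4 * (s * s) * M * (L * L)
    regroup-right = solve-∀

scale : ℕ → ℕ
scale n = suc (n + n) ! * suc (n + n) ! * suc (n + n) !

denom∣scale : ∀ {n a b} → a ≤ n → b ≤ n → denom a b ∣ scale n
denom∣scale {n} a≤n b≤n =
  *-pres-∣ (*-pres-∣ (suc∣! (≤-trans a≤n (m≤m+n n n))) (suc∣! (≤-trans b≤n (m≤m+n n n))))
           (suc∣! (+-mono-≤ a≤n b≤n))
  where
  suc∣! : ∀ {k m} → k ≤ m → suc k ∣ suc m !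
  suc∣! {k} k≤m = ∣-trans (divides (k !) (*-comm (suc k) (k !))) (m≤n⇒m!∣n! (s≤s k≤m))

outdeg≤ : ∀ {n} (E : Adj n) (v : Fin n) → outdeg E v ≤ n
outdeg≤ {n} E v = subst₂ _≤_ (sym (outdeg-sum E v)) (trans (∑-const n 1) (*-identityʳ n))
                          (∑-mono (λ u → 𝟙≤1 (E v u)))

scaled-split : ∀ a b t → t * rejNum a b + t * selNum a b ≡ t * denom a b
scaled-split a b t = trans (sym (*-distribˡ-+ t (rejNum a b) (selNum a b))) (cong (t *_) (sym (denom-split a b)))

scaled-bound : ∀ a b t M → a * b ≤ M →
  9 * ((t * rejNum a b) * (t * rejNum a b)) ≤ (4 * M) * ((t * selNum a b) * (t * selNum a b))
scaled-bound a b t M ab≤M = begin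
  9 * ((t * r) * (t * r))        ≡⟨ regroup-left t r ⟨
  t * t * (9 * (r * r))          ≤⟨ *-monoʳ-≤ (t * t) (selection-bound a b) ⟩
  t * t * (4 * (s * s) * (a * b)) ≤⟨ *-monoʳ-≤ (t * t) (*-monoʳ-≤ (4 * (s * s)) ab≤M) ⟩
  t * t * (4 * (s * s) * M)      ≡⟨ regroup-right t s M ⟩
  (4 * M) * ((t * s) * (t * s))  ∎
  where
  open ≤-Reasoning
  r s : ℕ
  r = rejNum a b
  s = selNum a b
  regroup-left : ∀ t r → t * t * (9 * (r * r)) ≡ 9 * ((t * r) * (t * r))
  regroup-left = solve-∀
  regroup-right : ∀ t s M → t * t * (4 * (s * s) * M) ≡ (4 * M) * ((t * s) * (t * s))
  regroup-right = solve-∀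

scale≢0 : ∀ n → NonZero (scale n)
scale≢0 n = m*n≢0 (K * K) K {{m*n≢0 K K {{K≢0}} {{K≢0}}}} {{K≢0}}
  where
  K : ℕ
  K = suc (n + n) !
  K≢0 : NonZero K
  K≢0 = suc (n + n) !≢0

mainTheorem2 : (n : ℕ) (E : Adj n) → Loopless E → DigonFree E →
    Σ (Subset n) (λ S → Acyclic E S ×
      9 * (n ∸ ∣ S ∣) ^ 2 ≤ 4 * ∣ S ∣ ^ 2 * maxDegProd E)
mainTheorem2 n E loopless digonFree =
  tabulate S , S-acyclic ,
  subst (λ s → 9 * (n ∸ s) ^ 2 ≤ 4 * s ^ 2 * M) (sym (∣tabulate∣ S))
    (clear-scale n L (size S) M (sum sel) (sum rej) {{scale≢0 n}} masses sel≤ (square-bound-∑ 9 (4 * M) rej sel bound))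
  where
  L M : ℕ
  L = scale n
  M = maxDegProd E
  a b t rej sel : Fin n → ℕ
  a = outdeg E
  b = indeg E
  t v = L / denom (a v) (b v)
  rej v = t v * rejNum (a v) (b v)
  sel v = t v * selNum (a v) (b v)

  t-scales : ∀ v → t v * denom (a v) (b v) ≡ L
  t-scales v = trans (*-comm (t v) _) (m*[n/m]≡n (denom∣scale (outdeg≤ E v) (outdeg≤ (flip E) v)))

  open Greedy E loopless digonFree L (λ v → orderValues (a v) (b v) (t v) L (t-scales v))
  S : VSet n
  S = proj₁ greedy-selection
  S-acyclic : Acyclic E (tabulate S)
  S-acyclic = proj₁ (proj₂ greedy-selection)
  sel≤ : sum sel ≤ L * size S
  sel≤ = proj₂ (proj₂ greedy-selection)

  masses : sum rej + sum sel ≡ n * L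
  masses = trans (sym (∑-distrib-+ rej sel))
           (trans (sum-cong-≗ (λ v → trans (scaled-split (a v) (b v) (t v)) (t-scales v))) (∑-const n L))

  bound : ∀ v → 9 * (rej v * rej v) ≤ (4 * M) * (sel v * sel v)
  bound v = scaled-bound (a v) (b v) (t v) M (≤maxDegProd E v)
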